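{- Let $P(X) \in \mathbb{S}^{\infty}[\mathbf{A}\cup\{X\}]$. Then $X = P(X)$ has the least solution $P(0)$ and the greatest solution $P(0) + P'(1)^\infty$ in $\mathbb{S}^{\infty}[\mathbf{A}]$.
   Context: $\mathbb{S}^{\infty}[\mathbf{Z}]$ is the semiring of generalized absorptive polynomials over a finite indeterminate set $\mathbf{Z}$: a monomial is a map $m\colon\mathbf{Z}\to\mathbb{N}\cup\{\infty\}$ (multiplication adds exponents); $m_1$ absorbs $m_2$ if $m_1(Y)\le m_2(Y)$ for all $Y$; elements are antichains of monomials w.r.t. absorption; $P+Q$ is the set of absorption-maximal monomials of $P\cup Q$, $P\cdot Q$ the set of maximal monomials among products $m_1m_2$; $0=\emptyset$, $1=\{$constant monomial$\}$. It is absorptive ($1+a=1$) and fully continuous; least/greatest refer to the natural order ($a\le b$ iff $a+b=b$); $a^\infty:=\inf_{n\in\mathbb{N}}a^n$ (infimum w.r.t. the natural order). $\mathbf{A}$ is a finite set of indeterminates and $X\notin\mathbf{A}$; $P(a)$ denotes substitution of $a\in\mathbb{S}^{\infty}[\mathbf{A}]$ for $X$. $P'$ is the partial derivative w.r.t. $X$, defined inductively by $X'=1$, $Y'=0$ for $Y\neq X$, $(PQ)'=P'Q+PQ'$, $(P+Q)'=P'+Q'$, $(P^\infty)'=P^\infty\cdot P'$. -}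

module Defs where

open import Data.Nat using (ℕ; zero; suc)
open import Data.Bool using (Bool; true; false; _∧_; _∨_; not; T; if_then_else_)
open import Data.Fin using (Fin; zero; suc)
open import Data.List using (List; []; _∷_; _++_; map; foldr; filter; cartesianProductWith)
open import Data.Bool.ListAction using (any)
open import Data.List.Relation.Unary.All using (All)
open import Data.List.Relation.Unary.Any using (Any)
open import Data.Product using (_×_)
open import Relation.Nullary.Decidable using (does)
open import Relation.Unary using (Decidable)
open import Data.Bool.Properties using (T?)

data ℕ∞ : Set where
  fin : ℕ → ℕ∞
  ∞   : ℕ∞

_≤ℕᵇ_ : ℕ → ℕ → Bool
zero  ≤ℕᵇ _     = true
suc _ ≤ℕᵇ zero  = false
suc m ≤ℕᵇ suc n = m ≤ℕᵇ n

_≤∞ᵇ_ : ℕ∞ → ℕ∞ → Bool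
fin m ≤∞ᵇ fin n = m ≤ℕᵇ n
fin _ ≤∞ᵇ ∞     = true
∞     ≤∞ᵇ fin _ = false
∞     ≤∞ᵇ ∞     = true

_+∞_ : ℕ∞ → ℕ∞ → ℕ∞
fin m +∞ fin n = fin (m Data.Nat.+ n)
fin _ +∞ ∞     = ∞
∞     +∞ _     = ∞

Mon : ℕ → Set
Mon n = Fin n → ℕ∞

allFinᵇ : ∀ {n} → (Fin n → Bool) → Bool
allFinᵇ {zero}  f = true
allFinᵇ {suc n} f = f zero ∧ allFinᵇ (λ i → f (suc i))

absorbs : ∀ {n} → Mon n → Mon n → Bool
absorbs m₁ m₂ = allFinᵇ (λ Y → m₁ Y ≤∞ᵇ m₂ Y)

monEq : ∀ {n} → Mon n → Mon n → Bool
monEq m₁ m₂ = absorbs m₁ m₂ ∧ absorbs m₂ m₁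

strictlyAbsorbs : ∀ {n} → Mon n → Mon n → Bool
strictlyAbsorbs m₁ m₂ = absorbs m₁ m₂ ∧ not (absorbs m₂ m₁)

_·ₘ_ : ∀ {n} → Mon n → Mon n → Mon n
(m₁ ·ₘ m₂) Y = m₁ Y +∞ m₂ Y

constMon : ∀ {n} → Mon n
constMon _ = fin 0

eqFinᵇ : ∀ {n} → Fin n → Fin n → Bool
eqFinᵇ zero    zero    = true
eqFinᵇ zero    (suc _) = false
eqFinᵇ (suc _) zero    = false
eqFinᵇ (suc i) (suc j) = eqFinᵇ i j

varMon : ∀ {n} → Fin n → Mon n
varMon Y Z = if eqFinᵇ Y Z then fin 1 else fin 0

-- Generalized absorptive polynomials 𝕊∞[Fin n]:
-- an element is a (finite) set of monomials, represented by a list;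
-- equality is equality as sets of monomials.

Poly : ℕ → Set
Poly n = List (Mon n)

maximal : ∀ {n} → Poly n → Poly n
maximal L = filter (λ m → T? (not (any (λ m' → strictlyAbsorbs m' m) L))) L

IsAntichain : ∀ {n} → Poly n → Set
IsAntichain L = All (λ m₁ → All (λ m₂ → T (absorbs m₁ m₂) → T (absorbs m₂ m₁)) L) L

_⊆ₚ_ : ∀ {n} → Poly n → Poly n → Set
P ⊆ₚ Q = All (λ m → Any (λ m' → T (monEq m m')) Q) P

_≈_ : ∀ {n} → Poly n → Poly n → Set
P ≈ Q = (P ⊆ₚ Q) × (Q ⊆ₚ P)

infix 4 _≈_ _≤_
infixl 6 _+_
infixl 7 _·_

_+_ : ∀ {n} → Poly n → Poly n → Poly n
P + Q = maximal (P ++ Q)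

_·_ : ∀ {n} → Poly n → Poly n → Poly n
P · Q = maximal (cartesianProductWith _·ₘ_ P Q)

𝟘 : ∀ {n} → Poly n
𝟘 = []

𝟙 : ∀ {n} → Poly n
𝟙 = constMon ∷ []

varPoly : ∀ {n} → Fin n → Poly n
varPoly Y = varMon Y ∷ []

_≤_ : ∀ {n} → Poly n → Poly n → Set
a ≤ b = a + b ≈ b

_^_ : ∀ {n} → Poly n → ℕ → Poly n
a ^ zero  = 𝟙
a ^ suc j = a · (a ^ j)

IsInf : ∀ {n} → Poly n → (ℕ → Poly n) → Set
IsInf {n} c f = (∀ j → c ≤ f j) × ((d : Poly n) → (∀ j → d ≤ f j) → d ≤ c)

-- Polynomial expressions (for the inductive definition of P')

data Expr (n : ℕ) : Set where
  var  : Fin n → Expr n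
  zer  : Expr n
  one  : Expr n
  _⊕_  : Expr n → Expr n → Expr n
  _⊗_  : Expr n → Expr n → Expr n
  _^∞E : Expr n → Expr n

powE : ∀ {n} → Expr n → ℕ∞ → Expr n
powE e (fin zero)    = one
powE e (fin (suc j)) = e ⊗ powE e (fin j)
powE e ∞             = e ^∞E

prodFin : ∀ {n k} → (Fin k → Expr n) → Expr n
prodFin {k = zero}  f = one
prodFin {k = suc k} f = f zero ⊗ prodFin (λ i → f (suc i))

monExpr : ∀ {n} → Mon n → Expr n
monExpr m = prodFin (λ Y → powE (var Y) (m Y))

polyExpr : ∀ {n} → Poly n → Expr n
polyExpr P = foldr _⊕_ zer (map monExpr P)

eval : ∀ {n m} → (∀ {k} → Poly k → Poly k) → (Fin n → Poly m) → Expr n → Poly m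
eval inf ρ (var Y)  = ρ Y
eval inf ρ zer      = 𝟘
eval inf ρ one      = 𝟙
eval inf ρ (e ⊕ f)  = eval inf ρ e + eval inf ρ f
eval inf ρ (e ⊗ f)  = eval inf ρ e · eval inf ρ f
eval inf ρ (e ^∞E)  = inf (eval inf ρ e)

-- The indeterminate X is `zero : Fin (suc k)`; A is embedded via `suc`.
-- Partial derivative w.r.t. X (constants have derivative 0).
deriv : ∀ {k} → Expr (suc k) → Expr (suc k)
deriv (var zero)    = one
deriv (var (suc _)) = zer
deriv zer           = zer
deriv one           = zer
deriv (e ⊕ f)       = deriv e ⊕ deriv f
deriv (e ⊗ f)       = (deriv e ⊗ f) ⊕ (e ⊗ deriv f)
deriv (e ^∞E)       = (e ^∞E) ⊗ deriv e

substEnv : ∀ {k} → Poly k → Fin (suc k) → Poly k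
substEnv a zero    = a
substEnv a (suc Y) = varPoly Y

subst : ∀ {k} → (∀ {n} → Poly n → Poly n) → Poly (suc k) → Poly k → Poly k
subst inf P a = eval inf (substEnv a) (polyExpr P)

derivPoly : ∀ {k} → (∀ {n} → Poly n → Poly n) → Poly (suc k) → Poly (suc k)
derivPoly inf P = eval inf varPoly (deriv (polyExpr P))

IsSolution : ∀ {k} → (∀ {n} → Poly n → Poly n) → Poly (suc k) → Poly k → Set
IsSolution inf P a = a ≈ subst inf P a

IsLeastSolution : ∀ {k} → (∀ {n} → Poly n → Poly n) → Poly (suc k) → Poly k → Set
IsLeastSolution {k} inf P s =
  IsSolution inf P s × ((a : Poly k) → IsAntichain a → IsSolution inf P a → s ≤ a)

IsGreatestSolution : ∀ {k} → (∀ {n} → Poly n → Poly n) → Poly (suc k) → Poly k → Set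
IsGreatestSolution {k} inf P s =
  IsSolution inf P s × ((a : Poly k) → IsAntichain a → IsSolution inf P a → a ≤ s)

-- A polynomial is determined by its up-set, the monomials it absorbs, and the operations become
-- operations on up-sets: + is union, · is the pointwise product, and a^∞ consists of the monomials
-- above some x^∞ with x ∈ a.  The last holds because a product of many factors below μ must contain
-- a factor x with x^∞ ⊑ μ: every other factor uses up part of a finite exponent of μ.
-- Splitting the monomials of P according to whether they contain X gives P(0) ≤ P(a) ≤ P(0) + P′(1)·a,
-- so P(0) is the least solution, and unfolding a solution a = P(a) gives a ≤ P(0) + P′(1)^j for all j,
-- hence a ≤ P(0) + P′(1)^∞ by the same counting.  Finally P′(1)^∞ is idempotent and absorbs every
-- monomial of P containing X, which makes P(0) + P′(1)^∞ a solution.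

module Submission where

open import Defs
open import Data.Nat using (ℕ; zero; suc; _∸_; z≤n; s≤s) renaming (_≤_ to _≤ℕ_; _<_ to _<ℕ_)
import Data.Nat as ℕ
import Data.Nat.Properties as ℕ
open import Data.Bool using (Bool; true; false; not; T)
open import Data.Bool.Properties using (T?; T-∧)
open import Data.Bool.ListAction using (any)
open import Data.Fin using (Fin; zero; suc)
open import Data.Fin.Properties using (¬∀⟶∃¬)
open import Data.List using (List; []; _∷_; _++_; map; foldr; cartesianProductWith)
open import Data.List.Relation.Unary.Any as Any using (Any; here; there)
open import Data.List.Relation.Unary.Any.Properties using (++⁺ˡ; ++⁺ʳ; ++⁻; any⁺; any⁻; map⁺; map⁻)
open import Data.List.Relation.Unary.All as All using (All; []; _∷_)
open import Data.List.Membership.Propositional using (_∈_; find; lose)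
open import Data.List.Membership.Propositional.Properties
  using (∈-filter⁺; ∈-filter⁻; ∈-cartesianProductWith⁺; ∈-cartesianProductWith⁻; ∈-map⁺)
open import Data.Product using (_×_; _,_; proj₁; proj₂; ∃; ∃₂)
open import Data.Sum using (_⊎_; inj₁; inj₂; [_,_]′) renaming (map to ⊎-map)
open import Data.Unit using (⊤; tt)
open import Data.Empty using (⊥; ⊥-elim)
open import Function using (_∘_; id)
open import Function.Bundles using (Equivalence)
open import Level using (0ℓ)
open import Relation.Nullary using (¬_; Dec; yes; no)
open import Relation.Unary using (Pred; _⊆_; _∪_; U)
open import Relation.Binary.PropositionalEquality
  using (_≡_; _≢_; _≗_; refl; sym; trans; cong; cong₂; module ≡-Reasoning) renaming (subst to ≡-subst)

infix 4 _≤∞_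
infix 25 ∞·_

_≤∞_ : ℕ∞ → ℕ∞ → Set
x ≤∞ y = T (x ≤∞ᵇ y)

≤ℕᵇ⇒≤ : ∀ m n → T (m ≤ℕᵇ n) → m ≤ℕ n
≤ℕᵇ⇒≤ zero    n       _ = z≤n
≤ℕᵇ⇒≤ (suc m) (suc n) p = s≤s (≤ℕᵇ⇒≤ m n p)

≤⇒≤ℕᵇ : ∀ {m n} → m ≤ℕ n → T (m ≤ℕᵇ n)
≤⇒≤ℕᵇ z≤n     = tt
≤⇒≤ℕᵇ (s≤s p) = ≤⇒≤ℕᵇ p

≤∞-refl : ∀ x → x ≤∞ x
≤∞-refl (fin n) = ≤⇒≤ℕᵇ (ℕ.≤-refl {n})
≤∞-refl ∞       = tt

≤∞-trans : ∀ x y z → x ≤∞ y → y ≤∞ z → x ≤∞ z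
≤∞-trans (fin a) (fin b) (fin c) p q = ≤⇒≤ℕᵇ (ℕ.≤-trans (≤ℕᵇ⇒≤ a b p) (≤ℕᵇ⇒≤ b c q))
≤∞-trans (fin _) (fin _) ∞       _ _ = tt
≤∞-trans (fin _) ∞       ∞       _ _ = tt
≤∞-trans ∞       ∞       ∞       _ _ = tt

≤∞-∞ : ∀ x → x ≤∞ ∞
≤∞-∞ (fin _) = tt
≤∞-∞ ∞       = tt

0≤∞ : ∀ x → fin 0 ≤∞ x
0≤∞ (fin _) = tt
0≤∞ ∞       = tt

+∞-identityˡ : ∀ x → fin 0 +∞ x ≡ x
+∞-identityˡ (fin _) = refl
+∞-identityˡ ∞       = refl

+∞-identityʳ : ∀ x → x +∞ fin 0 ≡ x
+∞-identityʳ (fin n) = cong fin (ℕ.+-identityʳ n)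
+∞-identityʳ ∞       = refl

+∞-comm : ∀ x y → x +∞ y ≡ y +∞ x
+∞-comm (fin a) (fin b) = cong fin (ℕ.+-comm a b)
+∞-comm (fin _) ∞       = refl
+∞-comm ∞       (fin _) = refl
+∞-comm ∞       ∞       = refl

+∞-assoc : ∀ x y z → (x +∞ y) +∞ z ≡ x +∞ (y +∞ z)
+∞-assoc (fin a) (fin b) (fin c) = cong fin (ℕ.+-assoc a b c)
+∞-assoc (fin _) (fin _) ∞       = refl
+∞-assoc (fin _) ∞       _       = refl
+∞-assoc ∞       _       _       = refl

x≤∞x+∞y : ∀ x y → x ≤∞ (x +∞ y)
x≤∞x+∞y (fin a) (fin b) = ≤⇒≤ℕᵇ (ℕ.m≤m+n a b)
x≤∞x+∞y (fin _) ∞       = tt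
x≤∞x+∞y ∞       _       = tt

+∞-mono-≤∞ : ∀ x x′ y y′ → x ≤∞ x′ → y ≤∞ y′ → (x +∞ y) ≤∞ (x′ +∞ y′)
+∞-mono-≤∞ (fin a) (fin a′) (fin b) (fin b′) p q = ≤⇒≤ℕᵇ (ℕ.+-mono-≤ (≤ℕᵇ⇒≤ a a′ p) (≤ℕᵇ⇒≤ b b′ q))
+∞-mono-≤∞ (fin _) (fin _)  (fin _) ∞        _ _ = tt
+∞-mono-≤∞ (fin _) (fin _)  ∞       ∞        _ _ = tt
+∞-mono-≤∞ (fin _) ∞        (fin _) _        _ _ = tt
+∞-mono-≤∞ (fin _) ∞        ∞       ∞        _ _ = tt
+∞-mono-≤∞ ∞       ∞        _       _        _ _ = tt

_≟0 : ∀ x → Dec (x ≡ fin 0)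
fin zero    ≟0 = yes refl
fin (suc _) ≟0 = no λ ()
∞           ≟0 = no λ ()

-- The exponent of Y in m^∞ is ∞·m(Y), with the convention ∞·0 = 0.
∞·_ : ℕ∞ → ℕ∞
∞· fin zero    = fin zero
∞· fin (suc _) = ∞
∞· ∞           = ∞

∞·-mono-≤∞ : ∀ x y → x ≤∞ y → ∞· x ≤∞ ∞· y
∞·-mono-≤∞ (fin zero)    y             _ = 0≤∞ (∞· y)
∞·-mono-≤∞ (fin (suc _)) (fin (suc _)) _ = tt
∞·-mono-≤∞ (fin (suc _)) ∞             _ = tt
∞·-mono-≤∞ ∞             ∞             _ = tt

x≤∞∞·x : ∀ x → x ≤∞ ∞· x
x≤∞∞·x (fin zero)    = tt
x≤∞∞·x (fin (suc _)) = tt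
x≤∞∞·x ∞             = tt

x+∞∞·x≡∞·x : ∀ x → x +∞ ∞· x ≡ ∞· x
x+∞∞·x≡∞·x (fin zero)    = refl
x+∞∞·x≡∞·x (fin (suc _)) = refl
x+∞∞·x≡∞·x ∞             = refl

∞·-idem : ∀ x → ∞· x +∞ ∞· x ≡ ∞· x
∞·-idem (fin zero)    = refl
∞·-idem (fin (suc _)) = refl
∞·-idem ∞             = refl

∞·∞·x≡∞·x : ∀ x → ∞· ∞· x ≡ ∞· x
∞·∞·x≡∞·x (fin zero)    = refl
∞·∞·x≡∞·x (fin (suc _)) = refl
∞·∞·x≡∞·x ∞             = refl

T-allFinᵇ⁻ : ∀ {n} (f : Fin n → Bool) → T (allFinᵇ f) → ∀ i → T (f i)
T-allFinᵇ⁻ f p zero    = proj₁ (Equivalence.to T-∧ p)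
T-allFinᵇ⁻ f p (suc i) = T-allFinᵇ⁻ (f ∘ suc) (proj₂ (Equivalence.to (T-∧ {f zero}) p)) i

T-allFinᵇ⁺ : ∀ {n} (f : Fin n → Bool) → (∀ i → T (f i)) → T (allFinᵇ f)
T-allFinᵇ⁺ {zero}  f h = tt
T-allFinᵇ⁺ {suc n} f h = Equivalence.from T-∧ (h zero , T-allFinᵇ⁺ (f ∘ suc) (h ∘ suc))

T-not⇒¬T : ∀ {b} → T (not b) → ¬ T b
T-not⇒¬T {true} ()

¬T⇒T-not : ∀ {b} → ¬ T b → T (not b)
¬T⇒T-not {true}  ¬t = ¬t tt
¬T⇒T-not {false} _  = tt

-- Absorption m₁ ⊑ m₂ is wrapped in a record so that m₁ and m₂ can be inferred from a proof.
record _⊑_ {n} (m₁ m₂ : Mon n) : Set where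
  constructor pointwise
  field exponent-≤ : ∀ Y → m₁ Y ≤∞ m₂ Y
open _⊑_

infix 4 _⊑_

absorbs⇒⊑ : ∀ {n} {m₁ m₂ : Mon n} → T (absorbs m₁ m₂) → m₁ ⊑ m₂
absorbs⇒⊑ {m₁ = m₁} {m₂} p = pointwise (T-allFinᵇ⁻ (λ Y → m₁ Y ≤∞ᵇ m₂ Y) p)

⊑⇒absorbs : ∀ {n} {m₁ m₂ : Mon n} → m₁ ⊑ m₂ → T (absorbs m₁ m₂)
⊑⇒absorbs {m₁ = m₁} {m₂} p = T-allFinᵇ⁺ (λ Y → m₁ Y ≤∞ᵇ m₂ Y) (exponent-≤ p)

_⊑?_ : ∀ {n} (m₁ m₂ : Mon n) → Dec (m₁ ⊑ m₂)
m₁ ⊑? m₂ with T? (absorbs m₁ m₂)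
... | yes p = yes (absorbs⇒⊑ p)
... | no ¬p = no (¬p ∘ ⊑⇒absorbs)

⊑-refl : ∀ {n} {m : Mon n} → m ⊑ m
⊑-refl {m = m} = pointwise (λ Y → ≤∞-refl (m Y))

⊑-trans : ∀ {n} {a b c : Mon n} → a ⊑ b → b ⊑ c → a ⊑ c
⊑-trans {a = a} {b} {c} p q =
  pointwise (λ Y → ≤∞-trans (a Y) (b Y) (c Y) (exponent-≤ p Y) (exponent-≤ q Y))

≗⇒⊑ : ∀ {n} {a b : Mon n} → a ≗ b → a ⊑ b
≗⇒⊑ {b = b} e = pointwise (λ Y → ≡-subst (_≤∞ b Y) (sym (e Y)) (≤∞-refl (b Y)))

constMon-⊑ : ∀ {n} (m : Mon n) → constMon ⊑ m
constMon-⊑ m = pointwise (λ Y → 0≤∞ (m Y))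

x⊑x·y : ∀ {n} (x y : Mon n) → x ⊑ x ·ₘ y
x⊑x·y x y = pointwise (λ Y → x≤∞x+∞y (x Y) (y Y))

·ₘ-comm : ∀ {n} (x y : Mon n) → x ·ₘ y ≗ y ·ₘ x
·ₘ-comm x y Y = +∞-comm (x Y) (y Y)

·ₘ-assoc : ∀ {n} (x y z : Mon n) → (x ·ₘ y) ·ₘ z ≗ x ·ₘ (y ·ₘ z)
·ₘ-assoc x y z Y = +∞-assoc (x Y) (y Y) (z Y)

·ₘ-identityˡ : ∀ {n} (x : Mon n) → constMon ·ₘ x ≗ x
·ₘ-identityˡ x Y = +∞-identityˡ (x Y)

·ₘ-identityʳ : ∀ {n} (x : Mon n) → x ·ₘ constMon ≗ x
·ₘ-identityʳ x Y = +∞-identityʳ (x Y)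

y⊑x·y : ∀ {n} (x y : Mon n) → y ⊑ x ·ₘ y
y⊑x·y x y = ⊑-trans (x⊑x·y y x) (≗⇒⊑ (·ₘ-comm y x))

·ₘ-mono-⊑ : ∀ {n} {x x′ y y′ : Mon n} → x ⊑ x′ → y ⊑ y′ → x ·ₘ y ⊑ x′ ·ₘ y′
·ₘ-mono-⊑ {x = x} {x′} {y} {y′} p q =
  pointwise (λ Y → +∞-mono-≤∞ (x Y) (x′ Y) (y Y) (y′ Y) (exponent-≤ p Y) (exponent-≤ q Y))

_^∞ₘ : ∀ {n} → Mon n → Mon n
(m ^∞ₘ) Y = ∞· m Y

^∞ₘ-mono-⊑ : ∀ {n} {x y : Mon n} → x ⊑ y → x ^∞ₘ ⊑ y ^∞ₘ
^∞ₘ-mono-⊑ {x = x} {y} p = pointwise (λ Y → ∞·-mono-≤∞ (x Y) (y Y) (exponent-≤ p Y))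

x⊑x^∞ : ∀ {n} (x : Mon n) → x ⊑ x ^∞ₘ
x⊑x^∞ x = pointwise (λ Y → x≤∞∞·x (x Y))

x^∞·x^∞⊑x^∞ : ∀ {n} (x : Mon n) → (x ^∞ₘ) ·ₘ (x ^∞ₘ) ⊑ x ^∞ₘ
x^∞·x^∞⊑x^∞ x = ≗⇒⊑ (λ Y → ∞·-idem (x Y))

x^∞^∞⊑x^∞ : ∀ {n} (x : Mon n) → (x ^∞ₘ) ^∞ₘ ⊑ x ^∞ₘ
x^∞^∞⊑x^∞ x = ≗⇒⊑ (λ Y → ∞·∞·x≡∞·x (x Y))

x^∞·x⊑x^∞ : ∀ {n} (x : Mon n) → (x ^∞ₘ) ·ₘ x ⊑ x ^∞ₘ
x^∞·x⊑x^∞ x = ≗⇒⊑ (λ Y → trans (+∞-comm _ (x Y)) (x+∞∞·x≡∞·x (x Y)))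

infix 10 ↑_

↑_ : ∀ {n} → Poly n → Pred (Mon n) 0ℓ
(↑ P) μ = Any (_⊑ μ) P

UpClosed : ∀ {n} → Pred (Mon n) 0ℓ → Set
UpClosed I = ∀ {x y} → I x → x ⊑ y → I y

↑-upClosed : ∀ {n} (P : Poly n) → UpClosed (↑ P)
↑-upClosed P p q = Any.map (λ r → ⊑-trans r q) p

∈⇒↑ : ∀ {n} {P : Poly n} {m} → m ∈ P → (↑ P) m
∈⇒↑ m∈ = lose m∈ ⊑-refl

↑-𝟙 : ∀ {n} → U ⊆ ↑ (𝟙 {n})
↑-𝟙 {x = μ} _ = here (constMon-⊑ μ)

Maximal : ∀ {n} → Poly n → Mon n → Set
Maximal L y = ∀ {w} → w ∈ L → w ⊑ y → y ⊑ w

maximal⁻ : ∀ {n} {L : Poly n} {y} → y ∈ maximal L → y ∈ L × Maximal L y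
maximal⁻ {L = L} {y} y∈ with ∈-filter⁻ (λ m → T? (not (any (λ m′ → strictlyAbsorbs m′ m) L))) y∈
... | y∈L , notDominated = y∈L , maximality
  where
  maximality : Maximal L y
  maximality {w} w∈ w⊑y with y ⊑? w
  ... | yes y⊑w = y⊑w
  ... | no  y⋢w = ⊥-elim (T-not⇒¬T notDominated (any⁺ (λ m′ → strictlyAbsorbs m′ y)
                    (lose w∈ (Equivalence.from T-∧ (⊑⇒absorbs w⊑y , ¬T⇒T-not (y⋢w ∘ absorbs⇒⊑))))))

maximal⁺ : ∀ {n} {L : Poly n} {y} → y ∈ L → Maximal L y → y ∈ maximal L
maximal⁺ {L = L} {y} y∈ y-max =
  ∈-filter⁺ (λ m → T? (not (any (λ m′ → strictlyAbsorbs m′ m) L))) y∈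
    (¬T⇒T-not (notDominated ∘ any⁻ (λ m′ → strictlyAbsorbs m′ y) L))
  where
  notDominated : ¬ Any (λ m′ → T (strictlyAbsorbs m′ y)) L
  notDominated dom with find dom
  ... | w , w∈ , w<y with Equivalence.to T-∧ w<y
  ...   | w⊑y , y⋢w = T-not⇒¬T y⋢w (⊑⇒absorbs (y-max w∈ (absorbs⇒⊑ w⊑y)))

maximal-cons : ∀ {n} (z : Mon n) {L : Poly n} {y} → y ∈ L → Maximal L y →
               ∃ λ t → t ∈ z ∷ L × t ⊑ y × Maximal (z ∷ L) t
maximal-cons z {y = y} y∈ y-max with z ⊑? y | y ⊑? z
... | yes z⊑y | yes y⊑z = y , there y∈ , ⊑-refl , λ { (here refl) _ → y⊑z ; (there w∈) → y-max w∈ }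
... | yes z⊑y | no  _   = z , here refl , z⊑y ,
                          λ { (here refl) p → p ; (there w∈) w⊑z → ⊑-trans z⊑y (y-max w∈ (⊑-trans w⊑z z⊑y)) }
... | no  z⋢y | _       = y , there y∈ , ⊑-refl , λ { (here refl) z⊑y → ⊥-elim (z⋢y z⊑y) ; (there w∈) → y-max w∈ }

maximal-below : ∀ {n} (L : Poly n) {x} → (↑ L) x → ∃ λ t → t ∈ L × t ⊑ x × Maximal L t
maximal-below (z ∷ L) (there p) with maximal-below L p
... | y , y∈ , y⊑x , y-max with maximal-cons z y∈ y-max
...   | t , t∈ , t⊑y , t-max = t , t∈ , ⊑-trans t⊑y y⊑x , t-max
maximal-below (z ∷ L) (here z⊑x) with Any.any? (_⊑? z) L
... | yes w⊑z with maximal-below L w⊑z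
...   | y , y∈ , y⊑z , y-max with maximal-cons z y∈ y-max
...     | t , t∈ , t⊑y , t-max = t , t∈ , ⊑-trans t⊑y (⊑-trans y⊑z z⊑x) , t-max
maximal-below (z ∷ L) (here z⊑x) | no nothing⊑z =
  z , here refl , z⊑x , λ { (here refl) p → p ; (there w∈) w⊑z → ⊥-elim (nothing⊑z (lose w∈ w⊑z)) }

↑-maximal⁻ : ∀ {n} {L : Poly n} → ↑ maximal L ⊆ ↑ L
↑-maximal⁻ p with find p
... | y , y∈ , y⊑μ = lose (proj₁ (maximal⁻ y∈)) y⊑μ

↑-maximal⁺ : ∀ {n} {L : Poly n} → ↑ L ⊆ ↑ maximal L
↑-maximal⁺ {L = L} p with maximal-below L p
... | t , t∈ , t⊑μ , t-max = lose (maximal⁺ t∈ t-max) t⊑μ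

maximal-antichain : ∀ {n} (L : Poly n) → IsAntichain (maximal L)
maximal-antichain L = All.tabulate λ m₁∈ → All.tabulate λ m₂∈ m₁⊑m₂ →
  ⊑⇒absorbs (proj₂ (maximal⁻ {L = L} m₂∈) (proj₁ (maximal⁻ {L = L} m₁∈)) (absorbs⇒⊑ m₁⊑m₂))

antichain-⊑ : ∀ {n} {L : Poly n} → IsAntichain L → ∀ {a b} → a ∈ L → b ∈ L → a ⊑ b → b ⊑ a
antichain-⊑ ac a∈ b∈ a⊑b = absorbs⇒⊑ (All.lookup (All.lookup ac a∈) b∈ (⊑⇒absorbs a⊑b))

monEq⁺ : ∀ {n} {a b : Mon n} → a ⊑ b → b ⊑ a → T (monEq a b)
monEq⁺ a⊑b b⊑a = Equivalence.from T-∧ (⊑⇒absorbs a⊑b , ⊑⇒absorbs b⊑a)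

monEq⁻ : ∀ {n} {a b : Mon n} → T (monEq a b) → b ⊑ a
monEq⁻ {a = a} p = absorbs⇒⊑ (proj₂ (Equivalence.to (T-∧ {absorbs a _}) p))

⊆ₚ⇒↑⊆ : ∀ {n} {P Q : Poly n} → P ⊆ₚ Q → ↑ P ⊆ ↑ Q
⊆ₚ⇒↑⊆ P⊆Q p with find p
... | x , x∈ , x⊑μ = Any.map (λ e → ⊑-trans (monEq⁻ e) x⊑μ) (All.lookup P⊆Q x∈)

≈⇒↑⊇ : ∀ {n} {a b : Poly n} → a ≈ b → ↑ b ⊆ ↑ a
≈⇒↑⊇ a≈b = ⊆ₚ⇒↑⊆ (proj₂ a≈b)

≈⇒↑⊆ : ∀ {n} {a b : Poly n} → a ≈ b → ↑ a ⊆ ↑ b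
≈⇒↑⊆ a≈b = ⊆ₚ⇒↑⊆ (proj₁ a≈b)

≤⇒↑⊆ : ∀ {n} {a b : Poly n} → a ≤ b → ↑ a ⊆ ↑ b
≤⇒↑⊆ a≤b p = ⊆ₚ⇒↑⊆ (proj₁ a≤b) (↑-maximal⁺ (++⁺ˡ p))

-- x ∈ A lies above some y ∈ B, which lies above some z ∈ A; as A is an antichain, x ⊑ z ⊑ y.
antichain-⊆ₚ : ∀ {n} {A B : Poly n} → IsAntichain A → ↑ A ⊆ ↑ B → ↑ B ⊆ ↑ A → A ⊆ₚ B
antichain-⊆ₚ acA A⊆B B⊆A = All.tabulate λ {x} x∈ → matchIn x∈ (find (A⊆B (∈⇒↑ x∈)))
  where
  matchIn : ∀ {x} → x ∈ _ → (∃ λ y → y ∈ _ × y ⊑ x) → Any (λ m → T (monEq x m)) _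
  matchIn x∈ (y , y∈ , y⊑x) with find (B⊆A (∈⇒↑ y∈))
  ... | z , z∈ , z⊑y = lose y∈ (monEq⁺ (⊑-trans (antichain-⊑ acA z∈ x∈ (⊑-trans z⊑y y⊑x)) z⊑y) y⊑x)

↑⊆⇒≤ : ∀ {n} {a b : Poly n} → IsAntichain b → ↑ a ⊆ ↑ b → a ≤ b
↑⊆⇒≤ {a = a} {b} acB a⊆b = antichain-⊆ₚ (maximal-antichain (a ++ b)) a+b⊆b b⊆a+b ,
                          antichain-⊆ₚ acB b⊆a+b a+b⊆b
  where
  a+b⊆b : ↑ (a + b) ⊆ ↑ b
  a+b⊆b p = [ a⊆b , id ]′ (++⁻ a (↑-maximal⁻ p))
  b⊆a+b : ↑ b ⊆ ↑ (a + b)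
  b⊆a+b p = ↑-maximal⁺ (++⁺ʳ a p)

↑≐⇒≈ : ∀ {n} {P Q : Poly n} → IsAntichain P → IsAntichain Q → ↑ P ⊆ ↑ Q → ↑ Q ⊆ ↑ P → P ≈ Q
↑≐⇒≈ acP acQ P⊆Q Q⊆P = antichain-⊆ₚ acP P⊆Q Q⊆P , antichain-⊆ₚ acQ Q⊆P P⊆Q

infixr 8 _⋆_

_⋆_ : ∀ {n} → Pred (Mon n) 0ℓ → Pred (Mon n) 0ℓ → Pred (Mon n) 0ℓ
(I ⋆ J) μ = ∃₂ λ x y → I x × J y × x ·ₘ y ⊑ μ

⋆-monoʳ : ∀ {n} {I J J′ : Pred (Mon n) 0ℓ} → J ⊆ J′ → I ⋆ J ⊆ I ⋆ J′
⋆-monoʳ J⊆J′ (x , y , Ix , Jy , xy⊑μ) = x , y , Ix , J⊆J′ Jy , xy⊑μ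

⋆-monoˡ : ∀ {n} {I I′ J : Pred (Mon n) 0ℓ} → I ⊆ I′ → I ⋆ J ⊆ I′ ⋆ J
⋆-monoˡ I⊆I′ (x , y , Ix , Jy , xy⊑μ) = x , y , I⊆I′ Ix , Jy , xy⊑μ

⋆-absorbʳ : ∀ {n} {I J : Pred (Mon n) 0ℓ} → UpClosed J → I ⋆ J ⊆ J
⋆-absorbʳ J↑ (x , y , _ , Jy , xy⊑μ) = J↑ Jy (⊑-trans (y⊑x·y x y) xy⊑μ)

↑-+⁻ : ∀ {n} (P Q : Poly n) → ↑ (P + Q) ⊆ ↑ P ∪ ↑ Q
↑-+⁻ P Q p = ++⁻ P (↑-maximal⁻ p)

↑-+⁺ˡ : ∀ {n} (P Q : Poly n) → ↑ P ⊆ ↑ (P + Q)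
↑-+⁺ˡ P Q p = ↑-maximal⁺ (++⁺ˡ p)

↑-+⁺ʳ : ∀ {n} (P Q : Poly n) → ↑ Q ⊆ ↑ (P + Q)
↑-+⁺ʳ P Q p = ↑-maximal⁺ (++⁺ʳ P p)

↑-·⁻ : ∀ {n} (P Q : Poly n) → ↑ (P · Q) ⊆ ↑ P ⋆ ↑ Q
↑-·⁻ P Q p with find (↑-maximal⁻ p)
... | v , v∈ , v⊑μ with ∈-cartesianProductWith⁻ _·ₘ_ P Q v∈
...   | x , y , x∈ , y∈ , refl = x , y , ∈⇒↑ x∈ , ∈⇒↑ y∈ , v⊑μ

↑-·⁺ : ∀ {n} (P Q : Poly n) → ↑ P ⋆ ↑ Q ⊆ ↑ (P · Q)
↑-·⁺ P Q (x , y , Px , Qy , xy⊑μ) with find Px | find Qy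
... | a , a∈ , a⊑x | b , b∈ , b⊑y =
  ↑-maximal⁺ (lose (∈-cartesianProductWith⁺ _·ₘ_ a∈ b∈) (⊑-trans (·ₘ-mono-⊑ a⊑x b⊑y) xy⊑μ))

Pow : ∀ {n} → Pred (Mon n) 0ℓ → ℕ∞ → Pred (Mon n) 0ℓ
Pow I (fin zero)    = U
Pow I (fin (suc j)) = I ⋆ Pow I (fin j)
Pow I ∞             = λ μ → ∃ λ x → I x × x ^∞ₘ ⊑ μ

Pow-nonzero : ∀ {n} {I : Pred (Mon n) 0ℓ} → UpClosed I → ∀ e → e ≢ fin 0 → Pow I e ⊆ I
Pow-nonzero I↑ (fin zero)    e≢0 _                           = ⊥-elim (e≢0 refl)
Pow-nonzero I↑ (fin (suc j)) _   (x , y , Ix , _ , xy⊑μ)    = I↑ Ix (⊑-trans (x⊑x·y x y) xy⊑μ)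
Pow-nonzero I↑ ∞             _   (x , Ix , x^∞⊑μ)           = I↑ Ix (⊑-trans (x⊑x^∞ x) x^∞⊑μ)

Pow-idempotent : ∀ {n} {I : Pred (Mon n) 0ℓ} {x} → I x → x ·ₘ x ⊑ x → x ^∞ₘ ⊑ x → ∀ e → Pow I e x
Pow-idempotent Ix xx⊑x x^∞⊑x (fin zero)    = tt
Pow-idempotent Ix xx⊑x x^∞⊑x (fin (suc j)) = _ , _ , Ix , Pow-idempotent Ix xx⊑x x^∞⊑x (fin j) , xx⊑x
Pow-idempotent Ix xx⊑x x^∞⊑x ∞             = _ , Ix , x^∞⊑x

Pow-^∞ₘ : ∀ {n} {I : Pred (Mon n) 0ℓ} {x} → I (x ^∞ₘ) → ∀ e → Pow I e (x ^∞ₘ)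
Pow-^∞ₘ {x = x} I = Pow-idempotent I (x^∞·x^∞⊑x^∞ x) (x^∞^∞⊑x^∞ x)

↑-^⁻ : ∀ {n} (a : Poly n) j → ↑ (a ^ j) ⊆ Pow (↑ a) (fin j)
↑-^⁻ a zero    _ = tt
↑-^⁻ a (suc j) p = ⋆-monoʳ (↑-^⁻ a j) (↑-·⁻ a (a ^ j) p)

↑-^⁺ : ∀ {n} (a : Poly n) j → Pow (↑ a) (fin j) ⊆ ↑ (a ^ j)
↑-^⁺ a zero    _ = ↑-𝟙 tt
↑-^⁺ a (suc j) p = ↑-·⁺ a (a ^ j) (⋆-monoʳ (↑-^⁺ a j) p)

^-antichain : ∀ {n} (a : Poly n) j → IsAntichain (a ^ j)
^-antichain a zero    = (id ∷ []) ∷ []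
^-antichain a (suc j) = maximal-antichain (cartesianProductWith _·ₘ_ a (a ^ j))

sumFin : ∀ {n} → (Fin n → ℕ) → ℕ
sumFin {zero}  f = 0
sumFin {suc n} f = f zero ℕ.+ sumFin (f ∘ suc)

sumFin-mono-≤ : ∀ {n} {f g : Fin n → ℕ} → (∀ i → f i ≤ℕ g i) → sumFin f ≤ℕ sumFin g
sumFin-mono-≤ {zero}  f≤g = z≤n
sumFin-mono-≤ {suc n} f≤g = ℕ.+-mono-≤ (f≤g zero) (sumFin-mono-≤ (f≤g ∘ suc))

sumFin-mono-< : ∀ {n} {f g : Fin n → ℕ} → (∀ i → f i ≤ℕ g i) → ∀ i → f i <ℕ g i → sumFin f <ℕ sumFin g
sumFin-mono-< f≤g zero    f<g = ℕ.+-mono-<-≤ f<g (sumFin-mono-≤ (f≤g ∘ suc))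
sumFin-mono-< f≤g (suc i) f<g = ℕ.+-mono-≤-< (f≤g zero) (sumFin-mono-< (f≤g ∘ suc) i f<g)

-- What is left of the exponent x after using up m; an infinite x counts as 0.
expGap : ℕ∞ → ℕ∞ → ℕ
expGap (fin b) (fin c) = b ∸ c
expGap _       _       = 0

expGap-mono : ∀ x m y → m +∞ y ≤∞ x → expGap x (m +∞ y) ≤ℕ expGap x m
expGap-mono (fin _) (fin c) (fin d) _ = ℕ.∸-monoʳ-≤ _ (ℕ.m≤m+n c d)
expGap-mono ∞       _       _       _ = z≤n

expGap-mono-< : ∀ x m y → m +∞ y ≤∞ x → ¬ (∞· y ≤∞ x) → expGap x (m +∞ y) <ℕ expGap x m
expGap-mono-< (fin b) (fin c) (fin zero)    _      y^∞≰x = ⊥-elim (y^∞≰x tt)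
expGap-mono-< (fin b) (fin c) (fin (suc t)) my≤x   _     =
  ℕ.∸-monoʳ-< (ℕ.m<m+n c (s≤s z≤n)) (≤ℕᵇ⇒≤ (c ℕ.+ suc t) b my≤x)
expGap-mono-< ∞       m       y             _      y^∞≰x = ⊥-elim (y^∞≰x (≤∞-∞ (∞· y)))

gap : ∀ {n} → Mon n → Mon n → ℕ
gap μ M = sumFin (λ Y → expGap (μ Y) (M Y))

gap-·-< : ∀ {n} {μ M y : Mon n} → M ·ₘ y ⊑ μ → ¬ (y ^∞ₘ ⊑ μ) → gap μ (M ·ₘ y) <ℕ gap μ M
gap-·-< {μ = μ} {M} {y} My⊑μ y^∞⋢μ with ¬∀⟶∃¬ _ (λ Y → ∞· y Y ≤∞ μ Y) (λ Y → T? _) (y^∞⋢μ ∘ pointwise)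
... | Y , y^∞≰μ = sumFin-mono-< (λ Z → expGap-mono (μ Z) (M Z) (y Z) (exponent-≤ My⊑μ Z)) Y
                    (expGap-mono-< (μ Y) (M Y) (y Y) (exponent-≤ My⊑μ Y) y^∞≰μ)

-- A factor y with y^∞ ⋢ μ raises some exponent of the prefix M that is finite in μ, so it lowers gap μ M;
-- hence among more than gap μ M factors one has y^∞ ⊑ μ.
Pow-long⇒Pow-∞ : ∀ {n} {I : Pred (Mon n) 0ℓ} μ M x j →
                 Pow I (fin j) x → M ·ₘ x ⊑ μ → gap μ M <ℕ j → Pow I ∞ μ
Pow-long⇒Pow-∞ μ M x (suc j) (y , z , Iy , Pz , yz⊑x) Mx⊑μ gap<j with (y ^∞ₘ) ⊑? μ
... | yes y^∞⊑μ = y , Iy , y^∞⊑μ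
... | no  y^∞⋢μ = Pow-long⇒Pow-∞ μ (M ·ₘ y) z j Pz My·z⊑μ
                    (ℕ.<-≤-trans (gap-·-< (⊑-trans (x⊑x·y (M ·ₘ y) z) My·z⊑μ) y^∞⋢μ) (ℕ.≤-pred gap<j))
  where
  My·z⊑μ : (M ·ₘ y) ·ₘ z ⊑ μ
  My·z⊑μ = ⊑-trans (≗⇒⊑ (·ₘ-assoc M y z)) (⊑-trans (·ₘ-mono-⊑ ⊑-refl yz⊑x) Mx⊑μ)

depth : ∀ {n} → Mon n → ℕ
depth μ = suc (gap μ constMon)

Pow-depth⇒Pow-∞ : ∀ {n} {I : Pred (Mon n) 0ℓ} μ → Pow I (fin (depth μ)) μ → Pow I ∞ μ
Pow-depth⇒Pow-∞ μ p = Pow-long⇒Pow-∞ μ constMon μ (depth μ) p (≗⇒⊑ (·ₘ-identityˡ μ)) (ℕ.n<1+n _)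

Pow-∞⇒↑-map^∞ₘ : ∀ {n} (a : Poly n) → Pow (↑ a) ∞ ⊆ ↑ map _^∞ₘ a
Pow-∞⇒↑-map^∞ₘ a (x , ax , x^∞⊑μ) with find ax
... | y , y∈ , y⊑x = lose (∈-map⁺ _^∞ₘ y∈) (⊑-trans (^∞ₘ-mono-⊑ y⊑x) x^∞⊑μ)

↑-map^∞ₘ⊆↑-^ : ∀ {n} (a : Poly n) j → ↑ map _^∞ₘ a ⊆ ↑ (a ^ j)
↑-map^∞ₘ⊆↑-^ a j p with find (map⁻ p)
... | z , z∈ , z^∞⊑μ =
  ↑-upClosed (a ^ j) (↑-^⁺ a j (Pow-^∞ₘ (↑-upClosed a (∈⇒↑ z∈) (x⊑x^∞ z)) (fin j))) z^∞⊑μ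

tl : ∀ {k} → Mon (suc k) → Mon k
tl m = m ∘ suc

tl-mono-⊑ : ∀ {k} {a b : Mon (suc k)} → a ⊑ b → tl a ⊑ tl b
tl-mono-⊑ a⊑b = pointwise (exponent-≤ a⊑b ∘ suc)

powₘ : ∀ {n} → Mon n → ℕ∞ → Mon n
powₘ m (fin zero)    = constMon
powₘ m (fin (suc j)) = m ·ₘ powₘ m (fin j)
powₘ m ∞             = m ^∞ₘ

prodₘ : ∀ {j n} → (Fin j → Mon n) → Mon n
prodₘ {zero}  g = constMon
prodₘ {suc j} g = g zero ·ₘ prodₘ (g ∘ suc)

varMonomial : ∀ {j n} → (Fin j → Fin n) → (Fin j → ℕ∞) → Mon n
varMonomial σ c = prodₘ (λ i → powₘ (varMon (σ i)) (c i))

powₘ-absent : ∀ {n} (m : Mon n) e Y → m Y ≡ fin 0 → powₘ m e Y ≡ fin 0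
powₘ-absent m (fin zero)    Y _    = refl
powₘ-absent m (fin (suc j)) Y m≡0 = cong₂ _+∞_ m≡0 (powₘ-absent m (fin j) Y m≡0)
powₘ-absent m ∞             Y m≡0 = cong ∞·_ m≡0

powₘ-single : ∀ {n} (m : Mon n) e Y → m Y ≡ fin 1 → powₘ m e Y ≡ e
powₘ-single m (fin zero)    Y _    = refl
powₘ-single m (fin (suc j)) Y m≡1 = cong₂ _+∞_ m≡1 (powₘ-single m (fin j) Y m≡1)
powₘ-single m ∞             Y m≡1 = cong ∞·_ m≡1

powₘ-tl : ∀ {k} (m : Mon (suc k)) e → tl (powₘ m e) ≗ powₘ (tl m) e
powₘ-tl m (fin zero)    Y = refl
powₘ-tl m (fin (suc j)) Y = cong (m (suc Y) +∞_) (powₘ-tl m (fin j) Y)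
powₘ-tl m ∞             Y = refl

varMonomial-suc-zero : ∀ {j k} (σ : Fin j → Fin k) c → varMonomial (λ i → suc (σ i)) c zero ≡ fin 0
varMonomial-suc-zero {zero}  σ c = refl
varMonomial-suc-zero {suc j} σ c =
  cong₂ _+∞_ (powₘ-absent (varMon (suc (σ zero))) (c zero) zero refl) (varMonomial-suc-zero (σ ∘ suc) (c ∘ suc))

tl-varMonomial-suc : ∀ {j k} (σ : Fin j → Fin k) c → tl (varMonomial (λ i → suc (σ i)) c) ≗ varMonomial σ c
tl-varMonomial-suc {zero}  σ c Y = refl
tl-varMonomial-suc {suc j} σ c Y =
  cong₂ _+∞_ (powₘ-tl (varMon (suc (σ zero))) (c zero) Y) (tl-varMonomial-suc (σ ∘ suc) (c ∘ suc) Y)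

varMonomial-id : ∀ {k} (c : Fin k → ℕ∞) → varMonomial id c ≗ c
varMonomial-id {suc k} c zero = begin
  powₘ (varMon zero) (c zero) zero +∞ varMonomial suc (c ∘ suc) zero
    ≡⟨ cong₂ _+∞_ (powₘ-single (varMon zero) (c zero) zero refl) (varMonomial-suc-zero id (c ∘ suc)) ⟩
  c zero +∞ fin 0
    ≡⟨ +∞-identityʳ (c zero) ⟩
  c zero ∎
  where open ≡-Reasoning
varMonomial-id {suc k} c (suc Y) = begin
  powₘ (varMon zero) (c zero) (suc Y) +∞ varMonomial suc (c ∘ suc) (suc Y)
    ≡⟨ cong₂ _+∞_ (powₘ-absent (varMon zero) (c zero) (suc Y) refl) (tl-varMonomial-suc id (c ∘ suc) Y) ⟩
  fin 0 +∞ varMonomial id (c ∘ suc) Y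
    ≡⟨ +∞-identityˡ _ ⟩
  varMonomial id (c ∘ suc) Y
    ≡⟨ varMonomial-id (c ∘ suc) Y ⟩
  c (suc Y) ∎
  where open ≡-Reasoning

tl-varMonomial : ∀ {k} (c : Fin k → ℕ∞) → tl (varMonomial suc c) ≗ c
tl-varMonomial c Y = trans (tl-varMonomial-suc id c Y) (varMonomial-id c Y)

Pow-principal⁻ : ∀ {n} (m : Mon n) e → Pow (↑ (m ∷ [])) e ⊆ (powₘ m e ⊑_)
Pow-principal⁻ m (fin zero)    {μ} _                                  = constMon-⊑ μ
Pow-principal⁻ m (fin (suc j)) (x , y , here m⊑x , Py , xy⊑μ) =
  ⊑-trans (·ₘ-mono-⊑ m⊑x (Pow-principal⁻ m (fin j) Py)) xy⊑μ
Pow-principal⁻ m ∞             (x , here m⊑x , x^∞⊑μ)              = ⊑-trans (^∞ₘ-mono-⊑ m⊑x) x^∞⊑μ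

Pow-principal⁺ : ∀ {n} (m : Mon n) e → (powₘ m e ⊑_) ⊆ Pow (↑ (m ∷ [])) e
Pow-principal⁺ m (fin zero)    _  = tt
Pow-principal⁺ m (fin (suc j)) m^e⊑μ = m , powₘ m (fin j) , here ⊑-refl , Pow-principal⁺ m (fin j) ⊑-refl , m^e⊑μ
Pow-principal⁺ m ∞             m^∞⊑μ = m , here ⊑-refl , m^∞⊑μ

varProduct : ∀ {j N} → (Fin j → Fin N) → (Fin j → ℕ∞) → Expr N
varProduct τ c = prodFin (λ i → powE (var (τ i)) (c i))

XFree : ∀ {k} → Expr (suc k) → Set
XFree (var zero)    = ⊥
XFree (var (suc _)) = ⊤
XFree zer           = ⊤
XFree one           = ⊤
XFree (e ⊕ f)       = XFree e × XFree f
XFree (e ⊗ f)       = XFree e × XFree f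
XFree (e ^∞E)       = XFree e

varProduct-XFree : ∀ {j k} (τ : Fin j → Fin k) c → XFree (varProduct (λ i → suc (τ i)) c)
varProduct-XFree {zero}  τ c = tt
varProduct-XFree {suc j} τ c = powX-free (c zero) , varProduct-XFree (τ ∘ suc) (c ∘ suc)
  where
  powX-free : ∀ e → XFree (powE (var (suc (τ zero))) e)
  powX-free (fin zero)    = tt
  powX-free (fin (suc j)) = tt , powX-free (fin j)
  powX-free ∞             = tt

deriv-polyExpr : ∀ {k} (P : Poly (suc k)) → deriv (polyExpr P) ≡ foldr _⊕_ zer (map (deriv ∘ monExpr) P)
deriv-polyExpr []      = refl
deriv-polyExpr (p ∷ P) = cong (deriv (monExpr p) ⊕_) (deriv-polyExpr P)

-- The up-set of the monomial p = X^(p X) · tl p with a substituted for X.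
SubstTerm : ∀ {k} → Poly k → Mon (suc k) → Pred (Mon k) 0ℓ
SubstTerm a p μ = ∃ λ x → Pow (↑ a) (p zero) x × x ·ₘ tl p ⊑ μ

SubstTerm⇒tl⊑ : ∀ {k} (a : Poly k) p {μ} → SubstTerm a p μ → tl p ⊑ μ
SubstTerm⇒tl⊑ a p (x , _ , x·p⊑μ) = ⊑-trans (y⊑x·y x (tl p)) x·p⊑μ

SubstTerm-split : ∀ {k} (a : Poly k) p {μ} → SubstTerm a p μ →
                  (p zero ≡ fin 0 × tl p ⊑ μ) ⊎ (p zero ≢ fin 0 × ((tl p ⊑_) ⋆ ↑ a) μ)
SubstTerm-split a p (x , Px , xp⊑μ) with p zero ≟0
... | yes p₀≡0 = inj₁ (p₀≡0 , SubstTerm⇒tl⊑ a p (x , Px , xp⊑μ))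
... | no  p₀≢0 = inj₂ (p₀≢0 , tl p , x , ⊑-refl , Pow-nonzero (↑-upClosed a) (p zero) p₀≢0 Px ,
                       ⊑-trans (≗⇒⊑ (·ₘ-comm (tl p) x)) xp⊑μ)

SubstTerm-𝟙 : ∀ {k} (p : Mon (suc k)) {μ} → tl p ⊑ μ → SubstTerm 𝟙 p μ
SubstTerm-𝟙 p tl⊑μ = constMon ,
  Pow-idempotent (↑-𝟙 tt) (≗⇒⊑ (·ₘ-identityˡ constMon)) (≗⇒⊑ λ _ → refl) (p zero) ,
  ⊑-trans (≗⇒⊑ (·ₘ-identityˡ (tl p))) tl⊑μ

AboveConstTerm : ∀ {k} → Poly (suc k) → Pred (Mon k) 0ℓ
AboveConstTerm P μ = Any (λ p → p zero ≡ fin 0 × tl p ⊑ μ) P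

AboveXTerm : ∀ {k} → Poly (suc k) → Pred (Mon k) 0ℓ
AboveXTerm P μ = Any (λ p → p zero ≢ fin 0 × tl p ⊑ μ) P

module Evaluation (inf : ∀ {n} → Poly n → Poly n)
                  (inf-isInf : ∀ {n} (a : Poly n) → IsInf (inf a) (λ j → a ^ j)) where

  ↑-inf⁺ : ∀ {n} (a : Poly n) → Pow (↑ a) ∞ ⊆ ↑ inf a
  ↑-inf⁺ a = ≤⇒↑⊆ (proj₂ (inf-isInf a) (map _^∞ₘ a) map^∞ₘ≤a^j) ∘ Pow-∞⇒↑-map^∞ₘ a
    where
    map^∞ₘ≤a^j : ∀ j → map _^∞ₘ a ≤ a ^ j
    map^∞ₘ≤a^j j = ↑⊆⇒≤ (^-antichain a j) (↑-map^∞ₘ⊆↑-^ a j)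

  ↑-inf⁻ : ∀ {n} (a : Poly n) → ↑ inf a ⊆ Pow (↑ a) ∞
  ↑-inf⁻ a {μ} p = Pow-depth⇒Pow-∞ μ (↑-^⁻ a (depth μ) (≤⇒↑⊆ (proj₁ (inf-isInf a) (depth μ)) p))

  infix 15 ⟦_⟧_

  ⟦_⟧_ : ∀ {N n} → Expr N → (Fin N → Poly n) → Poly n
  ⟦ e ⟧ ρ = eval inf ρ e

  ↑-powE⁻ : ∀ {N n} (ρ : Fin N → Poly n) Y e → ↑ ⟦ powE (var Y) e ⟧ ρ ⊆ Pow (↑ ρ Y) e
  ↑-powE⁻ ρ Y (fin zero)    _ = tt
  ↑-powE⁻ ρ Y (fin (suc j)) p = ⋆-monoʳ (↑-powE⁻ ρ Y (fin j)) (↑-·⁻ (ρ Y) _ p)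
  ↑-powE⁻ ρ Y ∞             p = ↑-inf⁻ (ρ Y) p

  ↑-powE⁺ : ∀ {N n} (ρ : Fin N → Poly n) Y e → Pow (↑ ρ Y) e ⊆ ↑ ⟦ powE (var Y) e ⟧ ρ
  ↑-powE⁺ ρ Y (fin zero)    _ = ↑-𝟙 tt
  ↑-powE⁺ ρ Y (fin (suc j)) p = ↑-·⁺ (ρ Y) _ (⋆-monoʳ (↑-powE⁺ ρ Y (fin j)) p)
  ↑-powE⁺ ρ Y ∞             p = ↑-inf⁺ (ρ Y) p

  ↑-prodFin⁻ : ∀ {N n j} (ρ : Fin N → Poly n) (f : Fin j → Expr N) (g : Fin j → Mon n) →
               (∀ i → ↑ ⟦ f i ⟧ ρ ⊆ (g i ⊑_)) → ↑ ⟦ prodFin f ⟧ ρ ⊆ (prodₘ g ⊑_)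
  ↑-prodFin⁻ {j = zero}  ρ f g fi⊆ {μ} _ = constMon-⊑ μ
  ↑-prodFin⁻ {j = suc j} ρ f g fi⊆ p with ↑-·⁻ (⟦ f zero ⟧ ρ) _ p
  ... | x , y , f₀x , fy , xy⊑μ =
    ⊑-trans (·ₘ-mono-⊑ (fi⊆ zero f₀x) (↑-prodFin⁻ ρ (f ∘ suc) (g ∘ suc) (fi⊆ ∘ suc) fy)) xy⊑μ

  ↑-prodFin⁺ : ∀ {N n j} (ρ : Fin N → Poly n) (f : Fin j → Expr N) (g : Fin j → Mon n) →
               (∀ i → (g i ⊑_) ⊆ ↑ ⟦ f i ⟧ ρ) → (prodₘ g ⊑_) ⊆ ↑ ⟦ prodFin f ⟧ ρ
  ↑-prodFin⁺ {j = zero}  ρ f g ⊆fi _ = ↑-𝟙 tt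
  ↑-prodFin⁺ {j = suc j} ρ f g ⊆fi g⊑μ = ↑-·⁺ (⟦ f zero ⟧ ρ) _
    (g zero , prodₘ (g ∘ suc) , ⊆fi zero ⊑-refl , ↑-prodFin⁺ ρ (f ∘ suc) (g ∘ suc) (⊆fi ∘ suc) ⊑-refl , g⊑μ)

  ↑-varProduct⁻ : ∀ {j N n} (ρ : Fin N → Poly n) τ σ (c : Fin j → ℕ∞) → (∀ i → ρ (τ i) ≡ varPoly (σ i)) →
                  ↑ ⟦ varProduct τ c ⟧ ρ ⊆ (varMonomial σ c ⊑_)
  ↑-varProduct⁻ ρ τ σ c ρτ≡σ = ↑-prodFin⁻ ρ _ _ λ i p →
    Pow-principal⁻ (varMon (σ i)) (c i) (≡-subst (λ r → Pow (↑ r) (c i) _) (ρτ≡σ i) (↑-powE⁻ ρ (τ i) (c i) p))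

  ↑-varProduct⁺ : ∀ {j N n} (ρ : Fin N → Poly n) τ σ (c : Fin j → ℕ∞) → (∀ i → ρ (τ i) ≡ varPoly (σ i)) →
                  (varMonomial σ c ⊑_) ⊆ ↑ ⟦ varProduct τ c ⟧ ρ
  ↑-varProduct⁺ ρ τ σ c ρτ≡σ = ↑-prodFin⁺ ρ _ _ λ i p →
    ↑-powE⁺ ρ (τ i) (c i) (≡-subst (λ r → Pow (↑ r) (c i) _) (sym (ρτ≡σ i)) (Pow-principal⁺ (varMon (σ i)) (c i) p))

  ↑-sum⁻ : ∀ {N n} (ρ : Fin N → Poly n) (es : List (Expr N)) →
           ↑ ⟦ foldr _⊕_ zer es ⟧ ρ ⊆ (λ μ → Any (λ e → (↑ ⟦ e ⟧ ρ) μ) es)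
  ↑-sum⁻ ρ (e ∷ es) p = [ here , there ∘ ↑-sum⁻ ρ es ]′ (↑-+⁻ (⟦ e ⟧ ρ) _ p)

  ↑-sum⁺ : ∀ {N n} (ρ : Fin N → Poly n) (es : List (Expr N)) →
           (λ μ → Any (λ e → (↑ ⟦ e ⟧ ρ) μ) es) ⊆ ↑ ⟦ foldr _⊕_ zer es ⟧ ρ
  ↑-sum⁺ ρ (e ∷ es) (here p)  = ↑-+⁺ˡ (⟦ e ⟧ ρ) _ p
  ↑-sum⁺ ρ (e ∷ es) (there p) = ↑-+⁺ʳ (⟦ e ⟧ ρ) _ (↑-sum⁺ ρ es p)

  sum-antichain : ∀ {N n} (ρ : Fin N → Poly n) (es : List (Expr N)) → IsAntichain (⟦ foldr _⊕_ zer es ⟧ ρ)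
  sum-antichain ρ []       = []
  sum-antichain ρ (e ∷ es) = maximal-antichain (⟦ e ⟧ ρ ++ ⟦ foldr _⊕_ zer es ⟧ ρ)

  ↑-monExpr-subst⁻ : ∀ {k} (a : Poly k) p → ↑ ⟦ monExpr p ⟧ substEnv a ⊆ SubstTerm a p
  ↑-monExpr-subst⁻ a p q with ↑-·⁻ (⟦ powE (var zero) (p zero) ⟧ substEnv a) _ q
  ... | x , y , x∈ , y∈ , xy⊑μ = x , ↑-powE⁻ (substEnv a) zero (p zero) x∈ , ⊑-trans (·ₘ-mono-⊑ ⊑-refl p⊑y) xy⊑μ
    where
    p⊑y : tl p ⊑ y
    p⊑y = ⊑-trans (≗⇒⊑ (sym ∘ varMonomial-id (tl p)))
                  (↑-varProduct⁻ (substEnv a) suc id (tl p) (λ _ → refl) y∈)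

  ↑-monExpr-subst⁺ : ∀ {k} (a : Poly k) p → SubstTerm a p ⊆ ↑ ⟦ monExpr p ⟧ substEnv a
  ↑-monExpr-subst⁺ a p (x , Px , x·p⊑μ) = ↑-·⁺ (⟦ powE (var zero) (p zero) ⟧ substEnv a) _
    (x , tl p , ↑-powE⁺ (substEnv a) zero (p zero) Px ,
     ↑-varProduct⁺ (substEnv a) suc id (tl p) (λ _ → refl) (≗⇒⊑ (varMonomial-id (tl p))) , x·p⊑μ)

  ↑-subst⁻ : ∀ {k} (P : Poly (suc k)) a → ↑ subst inf P a ⊆ (λ μ → Any (λ p → SubstTerm a p μ) P)
  ↑-subst⁻ P a = Any.map (λ {p} → ↑-monExpr-subst⁻ a p) ∘ map⁻ ∘ ↑-sum⁻ (substEnv a) (map monExpr P)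

  ↑-subst⁺ : ∀ {k} (P : Poly (suc k)) a → (λ μ → Any (λ p → SubstTerm a p μ) P) ⊆ ↑ subst inf P a
  ↑-subst⁺ P a = ↑-sum⁺ (substEnv a) (map monExpr P) ∘ map⁺ ∘ Any.map (λ {p} → ↑-monExpr-subst⁺ a p)

  subst-antichain : ∀ {k} (P : Poly (suc k)) a → IsAntichain (subst inf P a)
  subst-antichain P a = sum-antichain (substEnv a) (map monExpr P)

  -- Setting X := 1 projects an up-set onto the A-parts of its elements.
  ↑-subst-𝟙⁻ : ∀ {k} (L : Poly (suc k)) → ↑ subst inf L 𝟙 ⊆ (λ μ → ∃ λ ν → (↑ L) ν × tl ν ⊑ μ)
  ↑-subst-𝟙⁻ L p with find (↑-subst⁻ L 𝟙 p)
  ... | q , q∈ , t = q , ∈⇒↑ q∈ , SubstTerm⇒tl⊑ 𝟙 q t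

  ↑-subst-𝟙⁺ : ∀ {k} (L : Poly (suc k)) → (λ μ → ∃ λ ν → (↑ L) ν × tl ν ⊑ μ) ⊆ ↑ subst inf L 𝟙
  ↑-subst-𝟙⁺ L (ν , Lν , tlν⊑μ) with find Lν
  ... | q , q∈ , q⊑ν = ↑-subst⁺ L 𝟙 (lose q∈ (SubstTerm-𝟙 q (⊑-trans (tl-mono-⊑ q⊑ν) tlν⊑μ)))

  ↑-deriv-XFree : ∀ {k n} (ρ : Fin (suc k) → Poly n) e → XFree e → ∀ {μ} → ¬ (↑ ⟦ deriv e ⟧ ρ) μ
  ↑-deriv-XFree ρ (var (suc _)) _ ()
  ↑-deriv-XFree ρ zer           _ ()
  ↑-deriv-XFree ρ one           _ ()
  ↑-deriv-XFree ρ (e ⊕ f) (e-free , f-free) p =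
    [ ↑-deriv-XFree ρ e e-free , ↑-deriv-XFree ρ f f-free ]′ (↑-+⁻ (⟦ deriv e ⟧ ρ) _ p)
  ↑-deriv-XFree ρ (e ⊗ f) (e-free , f-free) p with ↑-+⁻ (⟦ deriv e ⊗ f ⟧ ρ) _ p
  ... | inj₁ q = let _ , _ , de , _ = ↑-·⁻ (⟦ deriv e ⟧ ρ) _ q in ↑-deriv-XFree ρ e e-free de
  ... | inj₂ q = let _ , _ , _ , df , _ = ↑-·⁻ (⟦ e ⟧ ρ) _ q in ↑-deriv-XFree ρ f f-free df
  ↑-deriv-XFree ρ (e ^∞E) e-free p =
    let _ , _ , _ , de , _ = ↑-·⁻ (⟦ e ^∞E ⟧ ρ) _ p in ↑-deriv-XFree ρ e e-free de

  ↑-deriv-powX⇒≢0 : ∀ {k n} (ρ : Fin (suc k) → Poly n) e {μ} → (↑ ⟦ deriv (powE (var zero) e) ⟧ ρ) μ → e ≢ fin 0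
  ↑-deriv-powX⇒≢0 ρ (fin zero) ()
  ↑-deriv-powX⇒≢0 ρ (fin (suc _)) _ ()
  ↑-deriv-powX⇒≢0 ρ ∞ _ ()

  X^∞ : ∀ {k} → Mon (suc k)
  X^∞ = varMon zero ^∞ₘ

  ↑-deriv-powX-X^∞ : ∀ {k} e → e ≢ fin 0 → (↑ ⟦ deriv (powE (var zero) e) ⟧ varPoly) (X^∞ {k})
  ↑-deriv-powX-X^∞ (fin zero)    e≢0 = ⊥-elim (e≢0 refl)
  ↑-deriv-powX-X^∞ (fin (suc j)) _   = ↑-+⁺ˡ (⟦ one ⊗ powE (var zero) (fin j) ⟧ varPoly) _ (↑-·⁺ 𝟙 _
    (constMon , X^∞ , ↑-𝟙 tt , ↑-powE⁺ varPoly zero (fin j) (Pow-^∞ₘ (here (x⊑x^∞ _)) (fin j)) ,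
     ≗⇒⊑ (·ₘ-identityˡ X^∞)))
  ↑-deriv-powX-X^∞ ∞             _   = ↑-·⁺ (inf (varPoly zero)) 𝟙
    (X^∞ , constMon , ↑-inf⁺ (varPoly zero) (varMon zero , here ⊑-refl , ⊑-refl) , ↑-𝟙 tt ,
     ≗⇒⊑ (·ₘ-identityʳ X^∞))

  -- In ∂(X^e · R) = ∂(X^e) · R + X^e · ∂R the second summand vanishes, R being X-free.
  ↑-deriv-monExpr⁻ : ∀ {k} (p : Mon (suc k)) {ν} →
                     (↑ ⟦ deriv (monExpr p) ⟧ varPoly) ν → p zero ≢ fin 0 × tl p ⊑ tl ν
  ↑-deriv-monExpr⁻ p q with ↑-+⁻ (⟦ deriv (powE (var zero) (p zero)) ⊗ varProduct suc (tl p) ⟧ varPoly) _ q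
  ... | inj₂ r = let _ , _ , _ , dR , _ = ↑-·⁻ (⟦ powE (var zero) (p zero) ⟧ varPoly) _ r
                 in ⊥-elim (↑-deriv-XFree varPoly (varProduct suc (tl p)) (varProduct-XFree id (tl p)) dR)
  ... | inj₁ r with ↑-·⁻ (⟦ deriv (powE (var zero) (p zero)) ⟧ varPoly) _ r
  ...   | x , y , dx , Ry , xy⊑ν = ↑-deriv-powX⇒≢0 varPoly (p zero) dx ,
    ⊑-trans (≗⇒⊑ (sym ∘ tl-varMonomial (tl p)))
      (tl-mono-⊑ (⊑-trans (↑-varProduct⁻ varPoly suc suc (tl p) (λ _ → refl) Ry) (⊑-trans (y⊑x·y x y) xy⊑ν)))

  -- X^∞ lies above every power of X, so it witnesses ∂(X^e) · R for every e ≠ 0.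
  ↑-deriv-monExpr⁺ : ∀ {k} (p : Mon (suc k)) → p zero ≢ fin 0 →
                     ∃ λ ν → (↑ ⟦ deriv (monExpr p) ⟧ varPoly) ν × tl ν ⊑ tl p
  ↑-deriv-monExpr⁺ p p₀≢0 = X^∞ ·ₘ varMonomial suc (tl p) ,
    ↑-+⁺ˡ (⟦ deriv (powE (var zero) (p zero)) ⊗ varProduct suc (tl p) ⟧ varPoly) _
      (↑-·⁺ (⟦ deriv (powE (var zero) (p zero)) ⟧ varPoly) _
        (X^∞ , varMonomial suc (tl p) , ↑-deriv-powX-X^∞ (p zero) p₀≢0 ,
         ↑-varProduct⁺ varPoly suc suc (tl p) (λ _ → refl) ⊑-refl , ⊑-refl)) ,
    ≗⇒⊑ (λ Y → trans (+∞-identityˡ _) (tl-varMonomial (tl p) Y))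

  ↑-derivPoly⁻ : ∀ {k} (P : Poly (suc k)) →
                 ↑ derivPoly inf P ⊆ (λ ν → Any (λ p → (↑ ⟦ deriv (monExpr p) ⟧ varPoly) ν) P)
  ↑-derivPoly⁻ P = map⁻ ∘ ↑-sum⁻ varPoly (map (deriv ∘ monExpr) P)
                 ∘ ≡-subst (λ e → (↑ ⟦ e ⟧ varPoly) _) (deriv-polyExpr P)

  ↑-derivPoly⁺ : ∀ {k} (P : Poly (suc k)) →
                 (λ ν → Any (λ p → (↑ ⟦ deriv (monExpr p) ⟧ varPoly) ν) P) ⊆ ↑ derivPoly inf P
  ↑-derivPoly⁺ P = ≡-subst (λ e → (↑ ⟦ e ⟧ varPoly) _) (sym (deriv-polyExpr P))
                 ∘ ↑-sum⁺ varPoly (map (deriv ∘ monExpr) P) ∘ map⁺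

  ↑-P′[1]⁻ : ∀ {k} (P : Poly (suc k)) → ↑ subst inf (derivPoly inf P) 𝟙 ⊆ AboveXTerm P
  ↑-P′[1]⁻ P p =
    let ν , P′ν , tlν⊑μ   = ↑-subst-𝟙⁻ (derivPoly inf P) p
        q , q∈ , dq       = find (↑-derivPoly⁻ P P′ν)
        q₀≢0 , tlq⊑tlν    = ↑-deriv-monExpr⁻ q dq
    in lose q∈ (q₀≢0 , ⊑-trans tlq⊑tlν tlν⊑μ)

  ↑-P′[1]⁺ : ∀ {k} (P : Poly (suc k)) → AboveXTerm P ⊆ ↑ subst inf (derivPoly inf P) 𝟙
  ↑-P′[1]⁺ P p =
    let q , q∈ , q₀≢0 , tlq⊑μ = find p
        ν , dν , tlν⊑tlq      = ↑-deriv-monExpr⁺ q q₀≢0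
    in ↑-subst-𝟙⁺ (derivPoly inf P) (ν , ↑-derivPoly⁺ P (lose q∈ dν) , ⊑-trans tlν⊑tlq tlq⊑μ)

  module Fixpoints {k} (P : Poly (suc k)) where

    P[_] : Poly k → Poly k
    P[ a ] = subst inf P a

    P′[1] : Poly k
    P′[1] = subst inf (derivPoly inf P) 𝟙

    P[0]+P′[1]^∞ : Poly k
    P[0]+P′[1]^∞ = P[ 𝟘 ] + inf P′[1]

    AboveConstTerm⊆↑P[a] : ∀ a → AboveConstTerm P ⊆ ↑ P[ a ]
    AboveConstTerm⊆↑P[a] a = ↑-subst⁺ P a ∘ Any.map λ { {p} (p₀≡0 , tlp⊑μ) →
      constMon , ≡-subst (λ e → Pow (↑ a) e constMon) (sym p₀≡0) tt , ⊑-trans (≗⇒⊑ (·ₘ-identityˡ (tl p))) tlp⊑μ }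

    ↑P[a]-split : ∀ a → ↑ P[ a ] ⊆ AboveConstTerm P ∪ (AboveXTerm P ⋆ ↑ a)
    ↑P[a]-split a p =
      let q , q∈ , t = find (↑-subst⁻ P a p) in
      [ (λ c → inj₁ (lose q∈ c)) ,
        (λ { (q₀≢0 , x , y , tlq⊑x , ay , xy⊑μ) → inj₂ (x , y , lose q∈ (q₀≢0 , tlq⊑x) , ay , xy⊑μ) }) ]′
        (SubstTerm-split a q t)

    ↑P[0]⊆↑P[a] : ∀ a → ↑ P[ 𝟘 ] ⊆ ↑ P[ a ]
    ↑P[0]⊆↑P[a] a = [ AboveConstTerm⊆↑P[a] a , (λ { (_ , _ , _ , () , _) }) ]′ ∘ ↑P[a]-split 𝟘

    ↑P[a]⊆↑P[0]∪↑P′[1]⋆↑a : ∀ a → ↑ P[ a ] ⊆ ↑ P[ 𝟘 ] ∪ (↑ P′[1] ⋆ ↑ a)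
    ↑P[a]⊆↑P[0]∪↑P′[1]⋆↑a a = ⊎-map (AboveConstTerm⊆↑P[a] 𝟘) (⋆-monoˡ (↑-P′[1]⁺ P)) ∘ ↑P[a]-split a

    ↑P[a]⊆↑P[0]∪↑a : ∀ a → ↑ P[ a ] ⊆ ↑ P[ 𝟘 ] ∪ ↑ a
    ↑P[a]⊆↑P[0]∪↑a a = ⊎-map id (⋆-absorbʳ (↑-upClosed a)) ∘ ↑P[a]⊆↑P[0]∪↑P′[1]⋆↑a a

    P[0]-solution : IsSolution inf P P[ 𝟘 ]
    P[0]-solution = ↑≐⇒≈ (subst-antichain P 𝟘) (subst-antichain P P[ 𝟘 ])
      (↑P[0]⊆↑P[a] P[ 𝟘 ]) ([ id , id ]′ ∘ ↑P[a]⊆↑P[0]∪↑a P[ 𝟘 ])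

    P[0]-least : (a : Poly k) → IsAntichain a → IsSolution inf P a → P[ 𝟘 ] ≤ a
    P[0]-least a a-antichain a≈P[a] = ↑⊆⇒≤ a-antichain (≈⇒↑⊇ a≈P[a] ∘ ↑P[0]⊆↑P[a] a)

    ↑P′[1]^∞⊆↑P[a] : ∀ a → ↑ inf P′[1] ⊆ ↑ a → ↑ inf P′[1] ⊆ ↑ P[ a ]
    ↑P′[1]^∞⊆↑P[a] a P′[1]^∞⊆a p =
      let x , P′[1]x , x^∞⊑μ      = ↑-inf⁻ P′[1] p
          q , q∈ , q₀≢0 , tlq⊑x = find (↑-P′[1]⁻ P P′[1]x)
          a∋tlq^∞ = P′[1]^∞⊆a (↑-inf⁺ P′[1] (tl q , ↑-P′[1]⁺ P (lose q∈ (q₀≢0 , ⊑-refl)) , ⊑-refl))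
      in ↑-subst⁺ P a (lose q∈ (tl q ^∞ₘ , Pow-^∞ₘ a∋tlq^∞ (q zero) ,
           ⊑-trans (x^∞·x⊑x^∞ (tl q)) (⊑-trans (^∞ₘ-mono-⊑ tlq⊑x) x^∞⊑μ)))

    P[0]+P′[1]^∞-solution : IsSolution inf P P[0]+P′[1]^∞
    P[0]+P′[1]^∞-solution = ↑≐⇒≈ (maximal-antichain (P[ 𝟘 ] ++ inf P′[1])) (subst-antichain P P[0]+P′[1]^∞)
      ([ ↑P[0]⊆↑P[a] P[0]+P′[1]^∞ , ↑P′[1]^∞⊆↑P[a] P[0]+P′[1]^∞ (↑-+⁺ʳ P[ 𝟘 ] _) ]′ ∘ ↑-+⁻ P[ 𝟘 ] _)
      ([ ↑-+⁺ˡ P[ 𝟘 ] _ , id ]′ ∘ ↑P[a]⊆↑P[0]∪↑a P[0]+P′[1]^∞)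

    solution⊆↑P[0]∪↑P′[1]^j : ∀ a → IsSolution inf P a → ∀ j → ↑ a ⊆ ↑ P[ 𝟘 ] ∪ ↑ (P′[1] ^ j)
    solution⊆↑P[0]∪↑P′[1]^j a a≈P[a] zero    _ = inj₂ (↑-𝟙 tt)
    solution⊆↑P[0]∪↑P′[1]^j a a≈P[a] (suc j) p =
      [ inj₁ , (λ { (q , x , P′[1]q , ax , qx⊑μ) →
                   ⊎-map (λ c → ↑-upClosed P[ 𝟘 ] c (⊑-trans (y⊑x·y q x) qx⊑μ))
                         (λ t → ↑-·⁺ P′[1] (P′[1] ^ j) (q , x , P′[1]q , t , qx⊑μ))
                         (solution⊆↑P[0]∪↑P′[1]^j a a≈P[a] j ax) }) ]′
        (↑P[a]⊆↑P[0]∪↑P′[1]⋆↑a a (≈⇒↑⊆ a≈P[a] p))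

    P[0]+P′[1]^∞-greatest : (a : Poly k) → IsAntichain a → IsSolution inf P a → a ≤ P[0]+P′[1]^∞
    P[0]+P′[1]^∞-greatest a _ a≈P[a] = ↑⊆⇒≤ (maximal-antichain (P[ 𝟘 ] ++ inf P′[1])) λ {μ} p →
      [ ↑-+⁺ˡ P[ 𝟘 ] _ , ↑-+⁺ʳ P[ 𝟘 ] _ ∘ ↑-inf⁺ P′[1] ∘ Pow-depth⇒Pow-∞ μ ∘ ↑-^⁻ P′[1] (depth μ) ]′
        (solution⊆↑P[0]∪↑P′[1]^j a a≈P[a] (depth μ) p)

theorem34 : (inf : ∀ {n} → Poly n → Poly n)
    → (∀ {n} (a : Poly n) → IsInf (inf a) (λ j → a ^ j))
    → (k : ℕ) (P : Poly (suc k)) → IsAntichain P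
    → IsLeastSolution inf P (subst inf P 𝟘)
      × IsGreatestSolution inf P (subst inf P 𝟘 + inf (subst inf (derivPoly inf P) 𝟙))
theorem34 inf inf-isInf k P _ =
  (P[0]-solution , P[0]-least) , (P[0]+P′[1]^∞-solution , P[0]+P′[1]^∞-greatest)
  where open Evaluation.Fixpoints inf inf-isInf P
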